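{- The cut rules $Cut^{a}$: from $(\Gamma;\Delta) \vdash^{+} D$ and $(\Gamma', D; \Delta') \vdash^{*} C$ infer $(\Gamma, \Gamma'; \Delta, \Delta') \vdash^{*} C$, and $Cut^{c}$: from $(\Gamma;\Delta) \vdash^{ - } D$ and $(\Gamma'; \Delta', D) \vdash^{*} C$ infer $(\Gamma, \Gamma'; \Delta, \Delta') \vdash^{*} C$, are admissible in SC2Int.
   Context: The language of the bi-intuitionistic logic 2Int is $A ::= p \mid \bot \mid \top \mid (A \wedge A) \mid (A \vee A) \mid (A \rightarrow A) \mid (A \mathbin{ -\!\!<} A)$, where $A \mathbin{ -\!\!<} B$ is co-implication (read "$B$ co-implies $A$"). Sequents have the form $(\Gamma; \Delta) \vdash^{*} C$ with $* \in \{+,-\}$, where $\Gamma$ (assumptions) and $\Delta$ (counterassumptions) are finite, possibly empty multisets. The calculus SC2Int has the following rules (for $* \in \{+,-\}$, $p$ atomic). Zero-premise rules: $(\Gamma, p; \Delta) \vdash^{+} p$; $(\Gamma; \Delta, p) \vdash^{ - } p$; $(\Gamma, \bot; \Delta) \vdash^{*} C$; $(\Gamma; \Delta, \top) \vdash^{*} C$; $(\Gamma; \Delta) \vdash^{ - } \bot$; $(\Gamma; \Delta) \vdash^{+} \top$. $\wedge R^{+}$: from $(\Gamma;\Delta)\vdash^{+}A$ and $(\Gamma;\Delta)\vdash^{+}B$ infer $(\Gamma;\Delta)\vdash^{+}A\wedge B$; $\wedge R^{ - }_{1,2}$: from $(\Gamma;\Delta)\vdash^{ - }A$ (resp. $B$)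 infer $(\Gamma;\Delta)\vdash^{ - }A\wedge B$; $\wedge L^{a}$: from $(\Gamma,A,B;\Delta)\vdash^{*}C$ infer $(\Gamma,A\wedge B;\Delta)\vdash^{*}C$; $\wedge L^{c}$: from $(\Gamma;\Delta,A)\vdash^{*}C$ and $(\Gamma;\Delta,B)\vdash^{*}C$ infer $(\Gamma;\Delta,A\wedge B)\vdash^{*}C$. $\vee R^{+}_{1,2}$: from $(\Gamma;\Delta)\vdash^{+}A$ (resp. $B$) infer $(\Gamma;\Delta)\vdash^{+}A\vee B$; $\vee R^{ - }$: from $(\Gamma;\Delta)\vdash^{ - }A$ and $(\Gamma;\Delta)\vdash^{ - }B$ infer $(\Gamma;\Delta)\vdash^{ - }A\vee B$; $\vee L^{a}$: from $(\Gamma,A;\Delta)\vdash^{*}C$ and $(\Gamma,B;\Delta)\vdash^{*}C$ infer $(\Gamma,A\vee B;\Delta)\vdash^{*}C$; $\vee L^{c}$: from $(\Gamma;\Delta,A,B)\vdash^{*}C$ infer $(\Gamma;\Delta,A\vee B)\vdash^{*}C$. $\rightarrow R^{+}$: from $(\Gamma,A;\Delta)\vdash^{+}B$ infer $(\Gamma;\Delta)\vdash^{+}A\rightarrow B$; $\rightarrow R^{ - }$: from $(\Gamma;\Delta)\vdash^{+}A$ and $(\Gamma;\Delta)\vdash^{ - }B$ infer $(\Gamma;\Delta)\vdash^{ - }A\rightarrow B$; $\rightarrow L^{a}$: from $(\Gamma,A\rightarrow B;\Delta)\vdash^{+}A$ and $(\Gamma,B;\Delta)\vdash^{*}C$ infer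 $(\Gamma,A\rightarrow B;\Delta)\vdash^{*}C$; $\rightarrow L^{c}$: from $(\Gamma,A;\Delta,B)\vdash^{*}C$ infer $(\Gamma;\Delta,A\rightarrow B)\vdash^{*}C$. Co-implication right $+$: from $(\Gamma;\Delta)\vdash^{+}A$ and $(\Gamma;\Delta)\vdash^{ - }B$ infer $(\Gamma;\Delta)\vdash^{+}A\mathbin{ -\!\!<}B$; right $-$: from $(\Gamma;\Delta,B)\vdash^{ - }A$ infer $(\Gamma;\Delta)\vdash^{ - }A\mathbin{ -\!\!<}B$; left $a$: from $(\Gamma,A;\Delta,B)\vdash^{*}C$ infer $(\Gamma,A\mathbin{ -\!\!<}B;\Delta)\vdash^{*}C$; left $c$: from $(\Gamma;\Delta,A\mathbin{ -\!\!<}B)\vdash^{ - }B$ and $(\Gamma;\Delta,A)\vdash^{*}C$ infer $(\Gamma;\Delta,A\mathbin{ -\!\!<}B)\vdash^{*}C$. No structural rules are primitive in SC2Int. -}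

module Defs where

open import Data.Nat using (ℕ)
open import Data.List using (List; []; _∷_; _++_)
open import Data.List.Relation.Binary.Permutation.Propositional using (_↭_)

-- Formulas of 2Int; propositional variables are indexed by ℕ.
-- A -< B is co-implication ("B co-implies A").
data Formula : Set where
  atom : ℕ → Formula
  ⊥f   : Formula
  ⊤f   : Formula
  _∧f_ : Formula → Formula → Formula
  _∨f_ : Formula → Formula → Formula
  _⇒f_ : Formula → Formula → Formula
  _-<_ : Formula → Formula → Formula

data Pol : Set where
  pos neg : Pol

-- Finite multisets are represented by lists; every rule is stated so that
-- its conclusion context is only required to be a permutation (↭) of the
-- displayed context, so derivability depends only on the underlying multisets.
Ctx : Set
Ctx = List Formula

-- SC2Int Γ Δ s C  :  the sequent (Γ; Δ) ⊢^s C is derivable in SC2Int.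
data SC2Int : Ctx → Ctx → Pol → Formula → Set where
  ax⁺  : ∀ {Γ Γ₀ Δ p} → Γ ↭ (atom p ∷ Γ₀) → SC2Int Γ Δ pos (atom p)
  ax⁻  : ∀ {Γ Δ Δ₀ p} → Δ ↭ (atom p ∷ Δ₀) → SC2Int Γ Δ neg (atom p)
  ⊥L   : ∀ {Γ Γ₀ Δ s C} → Γ ↭ (⊥f ∷ Γ₀) → SC2Int Γ Δ s C
  ⊤L   : ∀ {Γ Δ Δ₀ s C} → Δ ↭ (⊤f ∷ Δ₀) → SC2Int Γ Δ s C
  ⊥R⁻  : ∀ {Γ Δ} → SC2Int Γ Δ neg ⊥f
  ⊤R⁺  : ∀ {Γ Δ} → SC2Int Γ Δ pos ⊤f
  ∧R⁺  : ∀ {Γ Δ A B} → SC2Int Γ Δ pos A → SC2Int Γ Δ pos B → SC2Int Γ Δ pos (A ∧f B)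
  ∧R⁻₁ : ∀ {Γ Δ A B} → SC2Int Γ Δ neg A → SC2Int Γ Δ neg (A ∧f B)
  ∧R⁻₂ : ∀ {Γ Δ A B} → SC2Int Γ Δ neg B → SC2Int Γ Δ neg (A ∧f B)
  ∧Lᵃ  : ∀ {Γ Γ₀ Δ s C A B} → Γ ↭ ((A ∧f B) ∷ Γ₀) →
         SC2Int (A ∷ B ∷ Γ₀) Δ s C → SC2Int Γ Δ s C
  ∧Lᶜ  : ∀ {Γ Δ Δ₀ s C A B} → Δ ↭ ((A ∧f B) ∷ Δ₀) →
         SC2Int Γ (A ∷ Δ₀) s C → SC2Int Γ (B ∷ Δ₀) s C → SC2Int Γ Δ s C
  ∨R⁺₁ : ∀ {Γ Δ A B} → SC2Int Γ Δ pos A → SC2Int Γ Δ pos (A ∨f B)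
  ∨R⁺₂ : ∀ {Γ Δ A B} → SC2Int Γ Δ pos B → SC2Int Γ Δ pos (A ∨f B)
  ∨R⁻  : ∀ {Γ Δ A B} → SC2Int Γ Δ neg A → SC2Int Γ Δ neg B → SC2Int Γ Δ neg (A ∨f B)
  ∨Lᵃ  : ∀ {Γ Γ₀ Δ s C A B} → Γ ↭ ((A ∨f B) ∷ Γ₀) →
         SC2Int (A ∷ Γ₀) Δ s C → SC2Int (B ∷ Γ₀) Δ s C → SC2Int Γ Δ s C
  ∨Lᶜ  : ∀ {Γ Δ Δ₀ s C A B} → Δ ↭ ((A ∨f B) ∷ Δ₀) →
         SC2Int Γ (A ∷ B ∷ Δ₀) s C → SC2Int Γ Δ s C
  ⇒R⁺  : ∀ {Γ Δ A B} → SC2Int (A ∷ Γ) Δ pos B → SC2Int Γ Δ pos (A ⇒f B)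
  ⇒R⁻  : ∀ {Γ Δ A B} → SC2Int Γ Δ pos A → SC2Int Γ Δ neg B → SC2Int Γ Δ neg (A ⇒f B)
  ⇒Lᵃ  : ∀ {Γ Γ₀ Δ s C A B} → Γ ↭ ((A ⇒f B) ∷ Γ₀) →
         SC2Int Γ Δ pos A → SC2Int (B ∷ Γ₀) Δ s C → SC2Int Γ Δ s C
  ⇒Lᶜ  : ∀ {Γ Δ Δ₀ s C A B} → Δ ↭ ((A ⇒f B) ∷ Δ₀) →
         SC2Int (A ∷ Γ) (B ∷ Δ₀) s C → SC2Int Γ Δ s C
  -<R⁺ : ∀ {Γ Δ A B} → SC2Int Γ Δ pos A → SC2Int Γ Δ neg B → SC2Int Γ Δ pos (A -< B)
  -<R⁻ : ∀ {Γ Δ A B} → SC2Int Γ (B ∷ Δ) neg A → SC2Int Γ Δ neg (A -< B)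
  -<Lᵃ : ∀ {Γ Γ₀ Δ s C A B} → Γ ↭ ((A -< B) ∷ Γ₀) →
         SC2Int (A ∷ Γ₀) (B ∷ Δ) s C → SC2Int Γ Δ s C
  -<Lᶜ : ∀ {Γ Δ Δ₀ s C A B} → Δ ↭ ((A -< B) ∷ Δ₀) →
         SC2Int Γ Δ neg B → SC2Int Γ (A ∷ Δ₀) s C → SC2Int Γ Δ s C

CutᵃAdmissible : Set
CutᵃAdmissible = ∀ {Γ Δ Γ′ Δ′ D s C} →
  SC2Int Γ Δ pos D → SC2Int (D ∷ Γ′) Δ′ s C → SC2Int (Γ ++ Γ′) (Δ ++ Δ′) s C

CutᶜAdmissible : Set
CutᶜAdmissible = ∀ {Γ Δ Γ′ Δ′ D s C} →
  SC2Int Γ Δ neg D → SC2Int Γ′ (D ∷ Δ′) s C → SC2Int (Γ ++ Γ′) (Δ ++ Δ′) s C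

module Submission where

-- The cut rules are proved in their context-sharing form, from (Γ; Δ) ⊢⁺ D and
-- (D, Γ; Δ) ⊢* C infer (Γ; Δ) ⊢* C (dually for Cutᶜ); the stated rules follow by
-- weakening.  Sharing contexts makes contraction unnecessary.
--
-- On height-bounded derivations, weakening, exchange and the inversions of the
-- left rules are height-preserving.  The cut is eliminated by induction on the
-- cut formula D, then the height of the right premise, then the height of the
-- left premise.  If the left premise ends in a left rule, the cut moves into its
-- premises, the right premise being inverted to match.  If it ends in a right
-- rule introducing D, the cut moves into the right premise until D is principal
-- there too, and is then replaced by cuts on immediate subformulas.  In the
-- principal ⇒ case the first premise of ⇒Lᵃ still contains A ⇒ B, and is cut
-- against the unchanged left premise at smaller right height; the co-implication
-- case -<Lᶜ is dual.

open import Defs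
open import Data.Product using (_×_; _,_; ∃; proj₂)
open import Data.Sum using (_⊎_; inj₁; inj₂)
open import Data.Empty using (⊥; ⊥-elim)
open import Data.Nat using (ℕ; suc; _≤_; s≤s; _⊔_)
open import Data.Nat.Properties using (n≤1+n; m≤m⊔n; m≤n⊔m)
open import Data.List using ([]; _∷_; _++_; [_])
open import Data.List.Relation.Binary.Permutation.Propositional
open import Data.List.Relation.Binary.Permutation.Propositional.Properties
  using (shift; drop-∷; ++⁺ˡ; ∈-resp-↭; ++-comm)
open import Data.List.Membership.Propositional.Properties using (∈-∃++)
open import Data.List.Relation.Unary.Any using (here; there)
open import Relation.Binary.PropositionalEquality using (_≡_; refl)

private
  variable
    m n p : ℕ
    Γ Δ Γ₀ Δ₀ Γ′ Δ′ Γ₁ Δ₁ Γ₂ Δ₂ : Ctx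
    s s₁ s₂ : Pol
    A B C D X Y C₁ C₂ : Formula

↭-under : ∀ Ps → Γ ↭ X ∷ Γ₀ → Ps ++ Γ ↭ X ∷ Ps ++ Γ₀
↭-under {X = X} {Γ₀ = Γ₀} Ps p = trans (++⁺ˡ Ps p) (shift X Ps Γ₀)

↭-insert : ∀ A Ps → Γ ↭ Ps ++ Γ₀ → A ∷ Γ ↭ Ps ++ A ∷ Γ₀
↭-insert {Γ₀ = Γ₀} A Ps p = trans (prep A p) (↭-sym (shift A Ps Γ₀))

↭-∷-cases : A ∷ Γ ↭ B ∷ Δ → (A ≡ B × Γ ↭ Δ) ⊎ ∃ λ Γ₀ → Γ ↭ B ∷ Γ₀ × Δ ↭ A ∷ Γ₀
↭-∷-cases {A} {B = B} p with ∈-resp-↭ (↭-sym p) (here refl)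
... | here refl = inj₁ (refl , drop-∷ p)
... | there B∈Γ with ∈-∃++ B∈Γ
...   | Γₗ , Γᵣ , refl =
  inj₂ (Γₗ ++ Γᵣ , B-front , drop-∷ (trans (↭-sym p) (trans (prep A B-front) (swap A B refl))))
  where B-front = shift B Γₗ Γᵣ

data SC2Int≤ : ℕ → Ctx → Ctx → Pol → Formula → Set where
  ax⁺  : Γ ↭ (atom p ∷ Γ₀) → SC2Int≤ n Γ Δ pos (atom p)
  ax⁻  : Δ ↭ (atom p ∷ Δ₀) → SC2Int≤ n Γ Δ neg (atom p)
  ⊥L   : Γ ↭ (⊥f ∷ Γ₀) → SC2Int≤ n Γ Δ s C
  ⊤L   : Δ ↭ (⊤f ∷ Δ₀) → SC2Int≤ n Γ Δ s C
  ⊥R⁻  : SC2Int≤ n Γ Δ neg ⊥f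
  ⊤R⁺  : SC2Int≤ n Γ Δ pos ⊤f
  ∧R⁺  : SC2Int≤ n Γ Δ pos A → SC2Int≤ n Γ Δ pos B → SC2Int≤ (suc n) Γ Δ pos (A ∧f B)
  ∧R⁻₁ : SC2Int≤ n Γ Δ neg A → SC2Int≤ (suc n) Γ Δ neg (A ∧f B)
  ∧R⁻₂ : SC2Int≤ n Γ Δ neg B → SC2Int≤ (suc n) Γ Δ neg (A ∧f B)
  ∧Lᵃ  : Γ ↭ ((A ∧f B) ∷ Γ₀) → SC2Int≤ n (A ∷ B ∷ Γ₀) Δ s C → SC2Int≤ (suc n) Γ Δ s C
  ∧Lᶜ  : Δ ↭ ((A ∧f B) ∷ Δ₀) →
         SC2Int≤ n Γ (A ∷ Δ₀) s C → SC2Int≤ n Γ (B ∷ Δ₀) s C → SC2Int≤ (suc n) Γ Δ s C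
  ∨R⁺₁ : SC2Int≤ n Γ Δ pos A → SC2Int≤ (suc n) Γ Δ pos (A ∨f B)
  ∨R⁺₂ : SC2Int≤ n Γ Δ pos B → SC2Int≤ (suc n) Γ Δ pos (A ∨f B)
  ∨R⁻  : SC2Int≤ n Γ Δ neg A → SC2Int≤ n Γ Δ neg B → SC2Int≤ (suc n) Γ Δ neg (A ∨f B)
  ∨Lᵃ  : Γ ↭ ((A ∨f B) ∷ Γ₀) →
         SC2Int≤ n (A ∷ Γ₀) Δ s C → SC2Int≤ n (B ∷ Γ₀) Δ s C → SC2Int≤ (suc n) Γ Δ s C
  ∨Lᶜ  : Δ ↭ ((A ∨f B) ∷ Δ₀) → SC2Int≤ n Γ (A ∷ B ∷ Δ₀) s C → SC2Int≤ (suc n) Γ Δ s C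
  ⇒R⁺  : SC2Int≤ n (A ∷ Γ) Δ pos B → SC2Int≤ (suc n) Γ Δ pos (A ⇒f B)
  ⇒R⁻  : SC2Int≤ n Γ Δ pos A → SC2Int≤ n Γ Δ neg B → SC2Int≤ (suc n) Γ Δ neg (A ⇒f B)
  ⇒Lᵃ  : Γ ↭ ((A ⇒f B) ∷ Γ₀) →
         SC2Int≤ n Γ Δ pos A → SC2Int≤ n (B ∷ Γ₀) Δ s C → SC2Int≤ (suc n) Γ Δ s C
  ⇒Lᶜ  : Δ ↭ ((A ⇒f B) ∷ Δ₀) → SC2Int≤ n (A ∷ Γ) (B ∷ Δ₀) s C → SC2Int≤ (suc n) Γ Δ s C
  -<R⁺ : SC2Int≤ n Γ Δ pos A → SC2Int≤ n Γ Δ neg B → SC2Int≤ (suc n) Γ Δ pos (A -< B)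
  -<R⁻ : SC2Int≤ n Γ (B ∷ Δ) neg A → SC2Int≤ (suc n) Γ Δ neg (A -< B)
  -<Lᵃ : Γ ↭ ((A -< B) ∷ Γ₀) → SC2Int≤ n (A ∷ Γ₀) (B ∷ Δ) s C → SC2Int≤ (suc n) Γ Δ s C
  -<Lᶜ : Δ ↭ ((A -< B) ∷ Δ₀) →
         SC2Int≤ n Γ Δ neg B → SC2Int≤ n Γ (A ∷ Δ₀) s C → SC2Int≤ (suc n) Γ Δ s C

raise : m ≤ n → SC2Int≤ m Γ Δ s C → SC2Int≤ n Γ Δ s C
raise _       (ax⁺ x)       = ax⁺ x
raise _       (ax⁻ x)       = ax⁻ x
raise _       (⊥L x)        = ⊥L x
raise _       (⊤L x)        = ⊤L x
raise _       ⊥R⁻           = ⊥R⁻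
raise _       ⊤R⁺           = ⊤R⁺
raise (s≤s h) (∧R⁺ a b)     = ∧R⁺ (raise h a) (raise h b)
raise (s≤s h) (∧R⁻₁ a)      = ∧R⁻₁ (raise h a)
raise (s≤s h) (∧R⁻₂ a)      = ∧R⁻₂ (raise h a)
raise (s≤s h) (∧Lᵃ x a)     = ∧Lᵃ x (raise h a)
raise (s≤s h) (∧Lᶜ x a b)   = ∧Lᶜ x (raise h a) (raise h b)
raise (s≤s h) (∨R⁺₁ a)      = ∨R⁺₁ (raise h a)
raise (s≤s h) (∨R⁺₂ a)      = ∨R⁺₂ (raise h a)
raise (s≤s h) (∨R⁻ a b)     = ∨R⁻ (raise h a) (raise h b)
raise (s≤s h) (∨Lᵃ x a b)   = ∨Lᵃ x (raise h a) (raise h b)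
raise (s≤s h) (∨Lᶜ x a)     = ∨Lᶜ x (raise h a)
raise (s≤s h) (⇒R⁺ a)       = ⇒R⁺ (raise h a)
raise (s≤s h) (⇒R⁻ a b)     = ⇒R⁻ (raise h a) (raise h b)
raise (s≤s h) (⇒Lᵃ x a b)   = ⇒Lᵃ x (raise h a) (raise h b)
raise (s≤s h) (⇒Lᶜ x a)     = ⇒Lᶜ x (raise h a)
raise (s≤s h) (-<R⁺ a b)    = -<R⁺ (raise h a) (raise h b)
raise (s≤s h) (-<R⁻ a)      = -<R⁻ (raise h a)
raise (s≤s h) (-<Lᵃ x a)    = -<Lᵃ x (raise h a)
raise (s≤s h) (-<Lᶜ x a b)  = -<Lᶜ x (raise h a) (raise h b)

toSC2Int : SC2Int≤ n Γ Δ s C → SC2Int Γ Δ s C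
toSC2Int (ax⁺ x)      = ax⁺ x
toSC2Int (ax⁻ x)      = ax⁻ x
toSC2Int (⊥L x)       = ⊥L x
toSC2Int (⊤L x)       = ⊤L x
toSC2Int ⊥R⁻          = ⊥R⁻
toSC2Int ⊤R⁺          = ⊤R⁺
toSC2Int (∧R⁺ a b)    = ∧R⁺ (toSC2Int a) (toSC2Int b)
toSC2Int (∧R⁻₁ a)     = ∧R⁻₁ (toSC2Int a)
toSC2Int (∧R⁻₂ a)     = ∧R⁻₂ (toSC2Int a)
toSC2Int (∧Lᵃ x a)    = ∧Lᵃ x (toSC2Int a)
toSC2Int (∧Lᶜ x a b)  = ∧Lᶜ x (toSC2Int a) (toSC2Int b)
toSC2Int (∨R⁺₁ a)     = ∨R⁺₁ (toSC2Int a)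
toSC2Int (∨R⁺₂ a)     = ∨R⁺₂ (toSC2Int a)
toSC2Int (∨R⁻ a b)    = ∨R⁻ (toSC2Int a) (toSC2Int b)
toSC2Int (∨Lᵃ x a b)  = ∨Lᵃ x (toSC2Int a) (toSC2Int b)
toSC2Int (∨Lᶜ x a)    = ∨Lᶜ x (toSC2Int a)
toSC2Int (⇒R⁺ a)      = ⇒R⁺ (toSC2Int a)
toSC2Int (⇒R⁻ a b)    = ⇒R⁻ (toSC2Int a) (toSC2Int b)
toSC2Int (⇒Lᵃ x a b)  = ⇒Lᵃ x (toSC2Int a) (toSC2Int b)
toSC2Int (⇒Lᶜ x a)    = ⇒Lᶜ x (toSC2Int a)
toSC2Int (-<R⁺ a b)   = -<R⁺ (toSC2Int a) (toSC2Int b)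
toSC2Int (-<R⁻ a)     = -<R⁻ (toSC2Int a)
toSC2Int (-<Lᵃ x a)   = -<Lᵃ x (toSC2Int a)
toSC2Int (-<Lᶜ x a b) = -<Lᶜ x (toSC2Int a) (toSC2Int b)

SC2Intʰ : Ctx → Ctx → Pol → Formula → Set
SC2Intʰ Γ Δ s C = ∃ λ n → SC2Int≤ n Γ Δ s C

unary : (∀ {n} → SC2Int≤ n Γ₁ Δ₁ s₁ C₁ → SC2Int≤ (suc n) Γ Δ s C) →
        SC2Intʰ Γ₁ Δ₁ s₁ C₁ → SC2Intʰ Γ Δ s C
unary rule (n , a) = suc n , rule a

binary : (∀ {n} → SC2Int≤ n Γ₁ Δ₁ s₁ C₁ → SC2Int≤ n Γ₂ Δ₂ s₂ C₂ → SC2Int≤ (suc n) Γ Δ s C) →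
         SC2Intʰ Γ₁ Δ₁ s₁ C₁ → SC2Intʰ Γ₂ Δ₂ s₂ C₂ → SC2Intʰ Γ Δ s C
binary rule (m , a) (n , b) = suc (m ⊔ n) , rule (raise (m≤m⊔n m n) a) (raise (m≤n⊔m m n) b)

fromSC2Int : SC2Int Γ Δ s C → SC2Intʰ Γ Δ s C
fromSC2Int (ax⁺ x)      = 0 , ax⁺ x
fromSC2Int (ax⁻ x)      = 0 , ax⁻ x
fromSC2Int (⊥L x)       = 0 , ⊥L x
fromSC2Int (⊤L x)       = 0 , ⊤L x
fromSC2Int ⊥R⁻          = 0 , ⊥R⁻
fromSC2Int ⊤R⁺          = 0 , ⊤R⁺
fromSC2Int (∧R⁺ a b)    = binary ∧R⁺ (fromSC2Int a) (fromSC2Int b)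
fromSC2Int (∧R⁻₁ a)     = unary ∧R⁻₁ (fromSC2Int a)
fromSC2Int (∧R⁻₂ a)     = unary ∧R⁻₂ (fromSC2Int a)
fromSC2Int (∧Lᵃ x a)    = unary (∧Lᵃ x) (fromSC2Int a)
fromSC2Int (∧Lᶜ x a b)  = binary (∧Lᶜ x) (fromSC2Int a) (fromSC2Int b)
fromSC2Int (∨R⁺₁ a)     = unary ∨R⁺₁ (fromSC2Int a)
fromSC2Int (∨R⁺₂ a)     = unary ∨R⁺₂ (fromSC2Int a)
fromSC2Int (∨R⁻ a b)    = binary ∨R⁻ (fromSC2Int a) (fromSC2Int b)
fromSC2Int (∨Lᵃ x a b)  = binary (∨Lᵃ x) (fromSC2Int a) (fromSC2Int b)
fromSC2Int (∨Lᶜ x a)    = unary (∨Lᶜ x) (fromSC2Int a)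
fromSC2Int (⇒R⁺ a)      = unary ⇒R⁺ (fromSC2Int a)
fromSC2Int (⇒R⁻ a b)    = binary ⇒R⁻ (fromSC2Int a) (fromSC2Int b)
fromSC2Int (⇒Lᵃ x a b)  = binary (⇒Lᵃ x) (fromSC2Int a) (fromSC2Int b)
fromSC2Int (⇒Lᶜ x a)    = unary (⇒Lᶜ x) (fromSC2Int a)
fromSC2Int (-<R⁺ a b)   = binary -<R⁺ (fromSC2Int a) (fromSC2Int b)
fromSC2Int (-<R⁻ a)     = unary -<R⁻ (fromSC2Int a)
fromSC2Int (-<Lᵃ x a)   = unary (-<Lᵃ x) (fromSC2Int a)
fromSC2Int (-<Lᶜ x a b) = binary (-<Lᶜ x) (fromSC2Int a) (fromSC2Int b)

weaken : ∀ Ps Qs → Γ′ ↭ Ps ++ Γ → Δ′ ↭ Qs ++ Δ → SC2Int≤ n Γ Δ s C → SC2Int≤ n Γ′ Δ′ s C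
weaken Ps Qs g d (ax⁺ x)      = ax⁺ (trans g (↭-under Ps x))
weaken Ps Qs g d (ax⁻ x)      = ax⁻ (trans d (↭-under Qs x))
weaken Ps Qs g d (⊥L x)       = ⊥L (trans g (↭-under Ps x))
weaken Ps Qs g d (⊤L x)       = ⊤L (trans d (↭-under Qs x))
weaken Ps Qs g d ⊥R⁻          = ⊥R⁻
weaken Ps Qs g d ⊤R⁺          = ⊤R⁺
weaken Ps Qs g d (∧R⁺ a b)    = ∧R⁺ (weaken Ps Qs g d a) (weaken Ps Qs g d b)
weaken Ps Qs g d (∧R⁻₁ a)     = ∧R⁻₁ (weaken Ps Qs g d a)
weaken Ps Qs g d (∧R⁻₂ a)     = ∧R⁻₂ (weaken Ps Qs g d a)
weaken Ps Qs g d (∧Lᵃ x a)    =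
  ∧Lᵃ (trans g (↭-under Ps x)) (weaken Ps Qs (↭-insert _ Ps (↭-insert _ Ps refl)) d a)
weaken Ps Qs g d (∧Lᶜ x a b)  =
  ∧Lᶜ (trans d (↭-under Qs x)) (weaken Ps Qs g (↭-insert _ Qs refl) a) (weaken Ps Qs g (↭-insert _ Qs refl) b)
weaken Ps Qs g d (∨R⁺₁ a)     = ∨R⁺₁ (weaken Ps Qs g d a)
weaken Ps Qs g d (∨R⁺₂ a)     = ∨R⁺₂ (weaken Ps Qs g d a)
weaken Ps Qs g d (∨R⁻ a b)    = ∨R⁻ (weaken Ps Qs g d a) (weaken Ps Qs g d b)
weaken Ps Qs g d (∨Lᵃ x a b)  =
  ∨Lᵃ (trans g (↭-under Ps x)) (weaken Ps Qs (↭-insert _ Ps refl) d a) (weaken Ps Qs (↭-insert _ Ps refl) d b)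
weaken Ps Qs g d (∨Lᶜ x a)    =
  ∨Lᶜ (trans d (↭-under Qs x)) (weaken Ps Qs g (↭-insert _ Qs (↭-insert _ Qs refl)) a)
weaken Ps Qs g d (⇒R⁺ a)      = ⇒R⁺ (weaken Ps Qs (↭-insert _ Ps g) d a)
weaken Ps Qs g d (⇒R⁻ a b)    = ⇒R⁻ (weaken Ps Qs g d a) (weaken Ps Qs g d b)
weaken Ps Qs g d (⇒Lᵃ x a b)  =
  ⇒Lᵃ (trans g (↭-under Ps x)) (weaken Ps Qs g d a) (weaken Ps Qs (↭-insert _ Ps refl) d b)
weaken Ps Qs g d (⇒Lᶜ x a)    =
  ⇒Lᶜ (trans d (↭-under Qs x)) (weaken Ps Qs (↭-insert _ Ps g) (↭-insert _ Qs refl) a)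
weaken Ps Qs g d (-<R⁺ a b)   = -<R⁺ (weaken Ps Qs g d a) (weaken Ps Qs g d b)
weaken Ps Qs g d (-<R⁻ a)     = -<R⁻ (weaken Ps Qs g (↭-insert _ Qs d) a)
weaken Ps Qs g d (-<Lᵃ x a)   =
  -<Lᵃ (trans g (↭-under Ps x)) (weaken Ps Qs (↭-insert _ Ps refl) (↭-insert _ Qs d) a)
weaken Ps Qs g d (-<Lᶜ x a b) =
  -<Lᶜ (trans d (↭-under Qs x)) (weaken Ps Qs g d a) (weaken Ps Qs g (↭-insert _ Qs refl) b)

exchange : Γ′ ↭ Γ → Δ′ ↭ Δ → SC2Int≤ n Γ Δ s C → SC2Int≤ n Γ′ Δ′ s C
exchange = weaken [] []

-- Removing F from the assumptions and adding Ps to them and Qs to the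
-- counterassumptions; the fields handle the rules in which F is principal.
record AssumptionInversion (F : Formula) (Ps Qs : Ctx) : Set where
  field
    atom≢ : atom p ≡ F → ⊥
    ⊥≢    : ⊥f ≡ F → ⊥
    principal-∧  : (A ∧f B) ≡ F → SC2Int≤ n (A ∷ B ∷ Γ₁) Δ s C →
                   Γ₁ ↭ Γ₀ → Γ′ ↭ Ps ++ Γ₀ → Δ′ ↭ Qs ++ Δ → SC2Int≤ n Γ′ Δ′ s C
    principal-∨  : (A ∨f B) ≡ F → SC2Int≤ n (A ∷ Γ₁) Δ s C → SC2Int≤ n (B ∷ Γ₁) Δ s C →
                   Γ₁ ↭ Γ₀ → Γ′ ↭ Ps ++ Γ₀ → Δ′ ↭ Qs ++ Δ → SC2Int≤ n Γ′ Δ′ s C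
    principal-⇒  : (A ⇒f B) ≡ F → SC2Int≤ n (B ∷ Γ₁) Δ s C →
                   Γ₁ ↭ Γ₀ → Γ′ ↭ Ps ++ Γ₀ → Δ′ ↭ Qs ++ Δ → SC2Int≤ n Γ′ Δ′ s C
    principal-co : (A -< B) ≡ F → SC2Int≤ n (A ∷ Γ₁) (B ∷ Δ) s C →
                   Γ₁ ↭ Γ₀ → Γ′ ↭ Ps ++ Γ₀ → Δ′ ↭ Qs ++ Δ → SC2Int≤ n Γ′ Δ′ s C

module _ {F Ps Qs} (I : AssumptionInversion F Ps Qs) where
  open AssumptionInversion I

  invertᵃ : SC2Int≤ n Γ Δ s C → Γ ↭ F ∷ Γ₀ → Γ′ ↭ Ps ++ Γ₀ → Δ′ ↭ Qs ++ Δ → SC2Int≤ n Γ′ Δ′ s C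
  invertᵃ (ax⁺ x) e g d with ↭-∷-cases (trans (↭-sym x) e)
  ... | inj₁ (eq , _)      = ⊥-elim (atom≢ eq)
  ... | inj₂ (_ , _ , q)   = ax⁺ (trans g (↭-under Ps q))
  invertᵃ (ax⁻ x) e g d    = ax⁻ (trans d (↭-under Qs x))
  invertᵃ (⊥L x) e g d with ↭-∷-cases (trans (↭-sym x) e)
  ... | inj₁ (eq , _)      = ⊥-elim (⊥≢ eq)
  ... | inj₂ (_ , _ , q)   = ⊥L (trans g (↭-under Ps q))
  invertᵃ (⊤L x) e g d     = ⊤L (trans d (↭-under Qs x))
  invertᵃ ⊥R⁻ e g d        = ⊥R⁻
  invertᵃ ⊤R⁺ e g d        = ⊤R⁺
  invertᵃ (∧R⁺ a b) e g d  = ∧R⁺ (invertᵃ a e g d) (invertᵃ b e g d)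
  invertᵃ (∧R⁻₁ a) e g d   = ∧R⁻₁ (invertᵃ a e g d)
  invertᵃ (∧R⁻₂ a) e g d   = ∧R⁻₂ (invertᵃ a e g d)
  invertᵃ (∧Lᵃ x a) e g d with ↭-∷-cases (trans (↭-sym x) e)
  ... | inj₁ (eq , r)      = raise (n≤1+n _) (principal-∧ eq a r g d)
  ... | inj₂ (_ , r , q)   =
    ∧Lᵃ (trans g (↭-under Ps q)) (invertᵃ a (↭-under (_ ∷ _ ∷ []) r) (↭-insert _ Ps (↭-insert _ Ps refl)) d)
  invertᵃ (∧Lᶜ x a b) e g d =
    ∧Lᶜ (trans d (↭-under Qs x)) (invertᵃ a e g (↭-insert _ Qs refl)) (invertᵃ b e g (↭-insert _ Qs refl))
  invertᵃ (∨R⁺₁ a) e g d   = ∨R⁺₁ (invertᵃ a e g d)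
  invertᵃ (∨R⁺₂ a) e g d   = ∨R⁺₂ (invertᵃ a e g d)
  invertᵃ (∨R⁻ a b) e g d  = ∨R⁻ (invertᵃ a e g d) (invertᵃ b e g d)
  invertᵃ (∨Lᵃ x a b) e g d with ↭-∷-cases (trans (↭-sym x) e)
  ... | inj₁ (eq , r)      = raise (n≤1+n _) (principal-∨ eq a b r g d)
  ... | inj₂ (_ , r , q)   =
    ∨Lᵃ (trans g (↭-under Ps q)) (invertᵃ a (↭-under [ _ ] r) (↭-insert _ Ps refl) d)
                                 (invertᵃ b (↭-under [ _ ] r) (↭-insert _ Ps refl) d)
  invertᵃ (∨Lᶜ x a) e g d  = ∨Lᶜ (trans d (↭-under Qs x)) (invertᵃ a e g (↭-insert _ Qs (↭-insert _ Qs refl)))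
  invertᵃ (⇒R⁺ a) e g d    = ⇒R⁺ (invertᵃ a (↭-under [ _ ] e) (↭-insert _ Ps g) d)
  invertᵃ (⇒R⁻ a b) e g d  = ⇒R⁻ (invertᵃ a e g d) (invertᵃ b e g d)
  invertᵃ (⇒Lᵃ x a b) e g d with ↭-∷-cases (trans (↭-sym x) e)
  ... | inj₁ (eq , r)      = raise (n≤1+n _) (principal-⇒ eq b r g d)
  ... | inj₂ (_ , r , q)   =
    ⇒Lᵃ (trans g (↭-under Ps q)) (invertᵃ a e g d) (invertᵃ b (↭-under [ _ ] r) (↭-insert _ Ps refl) d)
  invertᵃ (⇒Lᶜ x a) e g d  =
    ⇒Lᶜ (trans d (↭-under Qs x)) (invertᵃ a (↭-under [ _ ] e) (↭-insert _ Ps g) (↭-insert _ Qs refl))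
  invertᵃ (-<R⁺ a b) e g d = -<R⁺ (invertᵃ a e g d) (invertᵃ b e g d)
  invertᵃ (-<R⁻ a) e g d   = -<R⁻ (invertᵃ a e g (↭-insert _ Qs d))
  invertᵃ (-<Lᵃ x a) e g d with ↭-∷-cases (trans (↭-sym x) e)
  ... | inj₁ (eq , r)      = raise (n≤1+n _) (principal-co eq a r g d)
  ... | inj₂ (_ , r , q)   =
    -<Lᵃ (trans g (↭-under Ps q)) (invertᵃ a (↭-under [ _ ] r) (↭-insert _ Ps refl) (↭-insert _ Qs d))
  invertᵃ (-<Lᶜ x a b) e g d =
    -<Lᶜ (trans d (↭-under Qs x)) (invertᵃ a e g d) (invertᵃ b e g (↭-insert _ Qs refl))

record CounterassumptionInversion (F : Formula) (Ps Qs : Ctx) : Set where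
  field
    atom≢ : atom p ≡ F → ⊥
    ⊤≢    : ⊤f ≡ F → ⊥
    principal-∧  : (A ∧f B) ≡ F → SC2Int≤ n Γ (A ∷ Δ₁) s C → SC2Int≤ n Γ (B ∷ Δ₁) s C →
                   Δ₁ ↭ Δ₀ → Γ′ ↭ Ps ++ Γ → Δ′ ↭ Qs ++ Δ₀ → SC2Int≤ n Γ′ Δ′ s C
    principal-∨  : (A ∨f B) ≡ F → SC2Int≤ n Γ (A ∷ B ∷ Δ₁) s C →
                   Δ₁ ↭ Δ₀ → Γ′ ↭ Ps ++ Γ → Δ′ ↭ Qs ++ Δ₀ → SC2Int≤ n Γ′ Δ′ s C
    principal-⇒  : (A ⇒f B) ≡ F → SC2Int≤ n (A ∷ Γ) (B ∷ Δ₁) s C →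
                   Δ₁ ↭ Δ₀ → Γ′ ↭ Ps ++ Γ → Δ′ ↭ Qs ++ Δ₀ → SC2Int≤ n Γ′ Δ′ s C
    principal-co : (A -< B) ≡ F → SC2Int≤ n Γ (A ∷ Δ₁) s C →
                   Δ₁ ↭ Δ₀ → Γ′ ↭ Ps ++ Γ → Δ′ ↭ Qs ++ Δ₀ → SC2Int≤ n Γ′ Δ′ s C

module _ {F Ps Qs} (I : CounterassumptionInversion F Ps Qs) where
  open CounterassumptionInversion I

  invertᶜ : SC2Int≤ n Γ Δ s C → Δ ↭ F ∷ Δ₀ → Γ′ ↭ Ps ++ Γ → Δ′ ↭ Qs ++ Δ₀ → SC2Int≤ n Γ′ Δ′ s C
  invertᶜ (ax⁺ x) e g d    = ax⁺ (trans g (↭-under Ps x))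
  invertᶜ (ax⁻ x) e g d with ↭-∷-cases (trans (↭-sym x) e)
  ... | inj₁ (eq , _)      = ⊥-elim (atom≢ eq)
  ... | inj₂ (_ , _ , q)   = ax⁻ (trans d (↭-under Qs q))
  invertᶜ (⊥L x) e g d     = ⊥L (trans g (↭-under Ps x))
  invertᶜ (⊤L x) e g d with ↭-∷-cases (trans (↭-sym x) e)
  ... | inj₁ (eq , _)      = ⊥-elim (⊤≢ eq)
  ... | inj₂ (_ , _ , q)   = ⊤L (trans d (↭-under Qs q))
  invertᶜ ⊥R⁻ e g d        = ⊥R⁻
  invertᶜ ⊤R⁺ e g d        = ⊤R⁺
  invertᶜ (∧R⁺ a b) e g d  = ∧R⁺ (invertᶜ a e g d) (invertᶜ b e g d)
  invertᶜ (∧R⁻₁ a) e g d   = ∧R⁻₁ (invertᶜ a e g d)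
  invertᶜ (∧R⁻₂ a) e g d   = ∧R⁻₂ (invertᶜ a e g d)
  invertᶜ (∧Lᵃ x a) e g d  = ∧Lᵃ (trans g (↭-under Ps x)) (invertᶜ a e (↭-insert _ Ps (↭-insert _ Ps refl)) d)
  invertᶜ (∧Lᶜ x a b) e g d with ↭-∷-cases (trans (↭-sym x) e)
  ... | inj₁ (eq , r)      = raise (n≤1+n _) (principal-∧ eq a b r g d)
  ... | inj₂ (_ , r , q)   =
    ∧Lᶜ (trans d (↭-under Qs q)) (invertᶜ a (↭-under [ _ ] r) g (↭-insert _ Qs refl))
                                 (invertᶜ b (↭-under [ _ ] r) g (↭-insert _ Qs refl))
  invertᶜ (∨R⁺₁ a) e g d   = ∨R⁺₁ (invertᶜ a e g d)
  invertᶜ (∨R⁺₂ a) e g d   = ∨R⁺₂ (invertᶜ a e g d)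
  invertᶜ (∨R⁻ a b) e g d  = ∨R⁻ (invertᶜ a e g d) (invertᶜ b e g d)
  invertᶜ (∨Lᵃ x a b) e g d =
    ∨Lᵃ (trans g (↭-under Ps x)) (invertᶜ a e (↭-insert _ Ps refl) d) (invertᶜ b e (↭-insert _ Ps refl) d)
  invertᶜ (∨Lᶜ x a) e g d with ↭-∷-cases (trans (↭-sym x) e)
  ... | inj₁ (eq , r)      = raise (n≤1+n _) (principal-∨ eq a r g d)
  ... | inj₂ (_ , r , q)   =
    ∨Lᶜ (trans d (↭-under Qs q)) (invertᶜ a (↭-under (_ ∷ _ ∷ []) r) g (↭-insert _ Qs (↭-insert _ Qs refl)))
  invertᶜ (⇒R⁺ a) e g d    = ⇒R⁺ (invertᶜ a e (↭-insert _ Ps g) d)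
  invertᶜ (⇒R⁻ a b) e g d  = ⇒R⁻ (invertᶜ a e g d) (invertᶜ b e g d)
  invertᶜ (⇒Lᵃ x a b) e g d =
    ⇒Lᵃ (trans g (↭-under Ps x)) (invertᶜ a e g d) (invertᶜ b e (↭-insert _ Ps refl) d)
  invertᶜ (⇒Lᶜ x a) e g d with ↭-∷-cases (trans (↭-sym x) e)
  ... | inj₁ (eq , r)      = raise (n≤1+n _) (principal-⇒ eq a r g d)
  ... | inj₂ (_ , r , q)   =
    ⇒Lᶜ (trans d (↭-under Qs q)) (invertᶜ a (↭-under [ _ ] r) (↭-insert _ Ps g) (↭-insert _ Qs refl))
  invertᶜ (-<R⁺ a b) e g d = -<R⁺ (invertᶜ a e g d) (invertᶜ b e g d)
  invertᶜ (-<R⁻ a) e g d   = -<R⁻ (invertᶜ a (↭-under [ _ ] e) g (↭-insert _ Qs d))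
  invertᶜ (-<Lᵃ x a) e g d =
    -<Lᵃ (trans g (↭-under Ps x)) (invertᶜ a (↭-under [ _ ] e) (↭-insert _ Ps refl) (↭-insert _ Qs d))
  invertᶜ (-<Lᶜ x a b) e g d with ↭-∷-cases (trans (↭-sym x) e)
  ... | inj₁ (eq , r)      = raise (n≤1+n _) (principal-co eq b r g d)
  ... | inj₂ (_ , r , q)   =
    -<Lᶜ (trans d (↭-under Qs q)) (invertᶜ a e g d) (invertᶜ b (↭-under [ _ ] r) g (↭-insert _ Qs refl))

∧Lᵃ-inv : SC2Int≤ n Γ Δ s C → Γ ↭ (A ∧f B) ∷ Γ₀ → Γ′ ↭ A ∷ B ∷ Γ₀ → Δ′ ↭ Δ → SC2Int≤ n Γ′ Δ′ s C
∧Lᵃ-inv {A = A} {B = B} = invertᵃ {Ps = A ∷ B ∷ []} {Qs = []} record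
  { atom≢ = λ () ; ⊥≢ = λ ()
  ; principal-∧ = λ { refl a r g d → exchange (trans g (prep _ (prep _ (↭-sym r)))) d a }
  ; principal-∨ = λ () ; principal-⇒ = λ () ; principal-co = λ () }

∨Lᵃ-inv₁ : SC2Int≤ n Γ Δ s C → Γ ↭ (A ∨f B) ∷ Γ₀ → Γ′ ↭ A ∷ Γ₀ → Δ′ ↭ Δ → SC2Int≤ n Γ′ Δ′ s C
∨Lᵃ-inv₁ {A = A} = invertᵃ {Ps = [ A ]} {Qs = []} record
  { atom≢ = λ () ; ⊥≢ = λ ()
  ; principal-∨ = λ { refl a b r g d → exchange (trans g (prep _ (↭-sym r))) d a }
  ; principal-∧ = λ () ; principal-⇒ = λ () ; principal-co = λ () }

∨Lᵃ-inv₂ : SC2Int≤ n Γ Δ s C → Γ ↭ (A ∨f B) ∷ Γ₀ → Γ′ ↭ B ∷ Γ₀ → Δ′ ↭ Δ → SC2Int≤ n Γ′ Δ′ s C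
∨Lᵃ-inv₂ {B = B} = invertᵃ {Ps = [ B ]} {Qs = []} record
  { atom≢ = λ () ; ⊥≢ = λ ()
  ; principal-∨ = λ { refl a b r g d → exchange (trans g (prep _ (↭-sym r))) d b }
  ; principal-∧ = λ () ; principal-⇒ = λ () ; principal-co = λ () }

⇒Lᵃ-inv : SC2Int≤ n Γ Δ s C → Γ ↭ (A ⇒f B) ∷ Γ₀ → Γ′ ↭ B ∷ Γ₀ → Δ′ ↭ Δ → SC2Int≤ n Γ′ Δ′ s C
⇒Lᵃ-inv {B = B} = invertᵃ {Ps = [ B ]} {Qs = []} record
  { atom≢ = λ () ; ⊥≢ = λ ()
  ; principal-⇒ = λ { refl b r g d → exchange (trans g (prep _ (↭-sym r))) d b }
  ; principal-∧ = λ () ; principal-∨ = λ () ; principal-co = λ () }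

-<Lᵃ-inv : SC2Int≤ n Γ Δ s C → Γ ↭ (A -< B) ∷ Γ₀ → Γ′ ↭ A ∷ Γ₀ → Δ′ ↭ B ∷ Δ → SC2Int≤ n Γ′ Δ′ s C
-<Lᵃ-inv {A = A} {B = B} = invertᵃ {Ps = [ A ]} {Qs = [ B ]} record
  { atom≢ = λ () ; ⊥≢ = λ ()
  ; principal-co = λ { refl a r g d → exchange (trans g (prep _ (↭-sym r))) d a }
  ; principal-∧ = λ () ; principal-∨ = λ () ; principal-⇒ = λ () }

∧Lᶜ-inv₁ : SC2Int≤ n Γ Δ s C → Δ ↭ (A ∧f B) ∷ Δ₀ → Γ′ ↭ Γ → Δ′ ↭ A ∷ Δ₀ → SC2Int≤ n Γ′ Δ′ s C
∧Lᶜ-inv₁ {A = A} = invertᶜ {Ps = []} {Qs = [ A ]} record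
  { atom≢ = λ () ; ⊤≢ = λ ()
  ; principal-∧ = λ { refl a b r g d → exchange g (trans d (prep _ (↭-sym r))) a }
  ; principal-∨ = λ () ; principal-⇒ = λ () ; principal-co = λ () }

∧Lᶜ-inv₂ : SC2Int≤ n Γ Δ s C → Δ ↭ (A ∧f B) ∷ Δ₀ → Γ′ ↭ Γ → Δ′ ↭ B ∷ Δ₀ → SC2Int≤ n Γ′ Δ′ s C
∧Lᶜ-inv₂ {B = B} = invertᶜ {Ps = []} {Qs = [ B ]} record
  { atom≢ = λ () ; ⊤≢ = λ ()
  ; principal-∧ = λ { refl a b r g d → exchange g (trans d (prep _ (↭-sym r))) b }
  ; principal-∨ = λ () ; principal-⇒ = λ () ; principal-co = λ () }

∨Lᶜ-inv : SC2Int≤ n Γ Δ s C → Δ ↭ (A ∨f B) ∷ Δ₀ → Γ′ ↭ Γ → Δ′ ↭ A ∷ B ∷ Δ₀ → SC2Int≤ n Γ′ Δ′ s C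
∨Lᶜ-inv {A = A} {B = B} = invertᶜ {Ps = []} {Qs = A ∷ B ∷ []} record
  { atom≢ = λ () ; ⊤≢ = λ ()
  ; principal-∨ = λ { refl a r g d → exchange g (trans d (prep _ (prep _ (↭-sym r)))) a }
  ; principal-∧ = λ () ; principal-⇒ = λ () ; principal-co = λ () }

⇒Lᶜ-inv : SC2Int≤ n Γ Δ s C → Δ ↭ (A ⇒f B) ∷ Δ₀ → Γ′ ↭ A ∷ Γ → Δ′ ↭ B ∷ Δ₀ → SC2Int≤ n Γ′ Δ′ s C
⇒Lᶜ-inv {A = A} {B = B} = invertᶜ {Ps = [ A ]} {Qs = [ B ]} record
  { atom≢ = λ () ; ⊤≢ = λ ()
  ; principal-⇒ = λ { refl a r g d → exchange g (trans d (prep _ (↭-sym r))) a }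
  ; principal-∧ = λ () ; principal-∨ = λ () ; principal-co = λ () }

-<Lᶜ-inv : SC2Int≤ n Γ Δ s C → Δ ↭ (A -< B) ∷ Δ₀ → Γ′ ↭ Γ → Δ′ ↭ A ∷ Δ₀ → SC2Int≤ n Γ′ Δ′ s C
-<Lᶜ-inv {A = A} = invertᶜ {Ps = []} {Qs = [ A ]} record
  { atom≢ = λ () ; ⊤≢ = λ ()
  ; principal-co = λ { refl a r g d → exchange g (trans d (prep _ (↭-sym r))) a }
  ; principal-∧ = λ () ; principal-∨ = λ () ; principal-⇒ = λ () }

data RightRule⁺ (Γ Δ : Ctx) : Formula → Set where
  ax⁺  : Γ ↭ atom p ∷ Γ₀ → RightRule⁺ Γ Δ (atom p)
  ⊤R⁺  : RightRule⁺ Γ Δ ⊤f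
  ∧R⁺  : SC2Int≤ m Γ Δ pos A → SC2Int≤ n Γ Δ pos B → RightRule⁺ Γ Δ (A ∧f B)
  ∨R⁺₁ : SC2Int≤ n Γ Δ pos A → RightRule⁺ Γ Δ (A ∨f B)
  ∨R⁺₂ : SC2Int≤ n Γ Δ pos B → RightRule⁺ Γ Δ (A ∨f B)
  ⇒R⁺  : SC2Int≤ n (A ∷ Γ) Δ pos B → RightRule⁺ Γ Δ (A ⇒f B)
  -<R⁺ : SC2Int≤ m Γ Δ pos A → SC2Int≤ n Γ Δ neg B → RightRule⁺ Γ Δ (A -< B)

data RightRule⁻ (Γ Δ : Ctx) : Formula → Set where
  ax⁻  : Δ ↭ atom p ∷ Δ₀ → RightRule⁻ Γ Δ (atom p)
  ⊥R⁻  : RightRule⁻ Γ Δ ⊥f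
  ∧R⁻₁ : SC2Int≤ n Γ Δ neg A → RightRule⁻ Γ Δ (A ∧f B)
  ∧R⁻₂ : SC2Int≤ n Γ Δ neg B → RightRule⁻ Γ Δ (A ∧f B)
  ∨R⁻  : SC2Int≤ m Γ Δ neg A → SC2Int≤ n Γ Δ neg B → RightRule⁻ Γ Δ (A ∨f B)
  ⇒R⁻  : SC2Int≤ m Γ Δ pos A → SC2Int≤ n Γ Δ neg B → RightRule⁻ Γ Δ (A ⇒f B)
  -<R⁻ : SC2Int≤ n Γ (B ∷ Δ) neg A → RightRule⁻ Γ Δ (A -< B)

-- cutᵃ and cutᶜ re-measure derivations built by recursive calls; they are only
-- applied to strictly smaller cut formulas.
mutual
  cutᵃ : ∀ D → SC2Int Γ Δ pos D → SC2Int Γ₁ Δ₁ s C → Γ₁ ↭ D ∷ Γ → Δ₁ ↭ Δ → SC2Int Γ Δ s C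
  cutᵃ D ⊢D D⊢C = cutᵃ≤ D _ _ (proj₂ (fromSC2Int ⊢D)) (proj₂ (fromSC2Int D⊢C))

  cutᶜ : ∀ D → SC2Int Γ Δ neg D → SC2Int Γ₁ Δ₁ s C → Γ₁ ↭ Γ → Δ₁ ↭ D ∷ Δ → SC2Int Γ Δ s C
  cutᶜ D ⊢D D⊢C = cutᶜ≤ D _ _ (proj₂ (fromSC2Int ⊢D)) (proj₂ (fromSC2Int D⊢C))

  cutᵃ≤ : ∀ D n m → SC2Int≤ n Γ Δ pos D → SC2Int≤ m Γ₁ Δ₁ s C →
         Γ₁ ↭ D ∷ Γ → Δ₁ ↭ Δ → SC2Int Γ Δ s C
  cutᵃ≤ D n m (⊥L x) r e f = ⊥L x
  cutᵃ≤ D n m (⊤L x) r e f = ⊤L x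
  cutᵃ≤ D (suc n) m (∧Lᵃ {A = X} {B = Y} x a) r e f =
    ∧Lᵃ x (cutᵃ≤ D n m a (∧Lᵃ-inv r (trans e (↭-under [ D ] x)) (↭-sym (↭-under (X ∷ Y ∷ []) refl)) refl)
                refl f)
  cutᵃ≤ D (suc n) m (∧Lᶜ x a b) r e f =
    ∧Lᶜ x (cutᵃ≤ D n m a (∧Lᶜ-inv₁ r (trans f x) refl refl) e refl)
          (cutᵃ≤ D n m b (∧Lᶜ-inv₂ r (trans f x) refl refl) e refl)
  cutᵃ≤ D (suc n) m (∨Lᵃ {A = X} {B = Y} x a b) r e f =
    ∨Lᵃ x (cutᵃ≤ D n m a (∨Lᵃ-inv₁ r (trans e (↭-under [ D ] x)) (swap D X refl) refl) refl f)
          (cutᵃ≤ D n m b (∨Lᵃ-inv₂ r (trans e (↭-under [ D ] x)) (swap D Y refl) refl) refl f)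
  cutᵃ≤ D (suc n) m (∨Lᶜ x a) r e f = ∨Lᶜ x (cutᵃ≤ D n m a (∨Lᶜ-inv r (trans f x) refl refl) e refl)
  cutᵃ≤ D (suc n) m (⇒Lᵃ {B = Y} x a b) r e f =
    ⇒Lᵃ x (toSC2Int a) (cutᵃ≤ D n m b (⇒Lᵃ-inv r (trans e (↭-under [ D ] x)) (swap D Y refl) refl) refl f)
  cutᵃ≤ D (suc n) m (⇒Lᶜ {A = X} x a) r e f =
    ⇒Lᶜ x (cutᵃ≤ D n m a (⇒Lᶜ-inv r (trans f x) refl refl) (↭-under [ X ] e) refl)
  cutᵃ≤ D (suc n) m (-<Lᵃ {A = X} {B = Y} x a) r e f =
    -<Lᵃ x (cutᵃ≤ D n m a (-<Lᵃ-inv r (trans e (↭-under [ D ] x)) (swap D X refl) refl) refl (prep Y f))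
  cutᵃ≤ D (suc n) m (-<Lᶜ x a b) r e f =
    -<Lᶜ x (toSC2Int a) (cutᵃ≤ D n m b (-<Lᶜ-inv r (trans f x) refl refl) e refl)
  cutᵃ≤ D n m l@(ax⁺ x)    r e f = cutᵃ≤-introduced D n m l (ax⁺ x) r e f
  cutᵃ≤ D n m l@⊤R⁺        r e f = cutᵃ≤-introduced D n m l ⊤R⁺ r e f
  cutᵃ≤ D n m l@(∧R⁺ a b)  r e f = cutᵃ≤-introduced D n m l (∧R⁺ a b) r e f
  cutᵃ≤ D n m l@(∨R⁺₁ a)   r e f = cutᵃ≤-introduced D n m l (∨R⁺₁ a) r e f
  cutᵃ≤ D n m l@(∨R⁺₂ a)   r e f = cutᵃ≤-introduced D n m l (∨R⁺₂ a) r e f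
  cutᵃ≤ D n m l@(⇒R⁺ a)    r e f = cutᵃ≤-introduced D n m l (⇒R⁺ a) r e f
  cutᵃ≤ D n m l@(-<R⁺ a b) r e f = cutᵃ≤-introduced D n m l (-<R⁺ a b) r e f

  cutᵃ≤-introduced : ∀ D n m → SC2Int≤ n Γ Δ pos D → RightRule⁺ Γ Δ D → SC2Int≤ m Γ₁ Δ₁ s C →
                    Γ₁ ↭ D ∷ Γ → Δ₁ ↭ Δ → SC2Int Γ Δ s C
  cutᵃ≤-introduced D n m l v (ax⁺ x) e f with ↭-∷-cases (trans (↭-sym x) e)
  ... | inj₁ (refl , _)    = toSC2Int l
  ... | inj₂ (_ , _ , q)   = ax⁺ q
  cutᵃ≤-introduced D n m l v (ax⁻ x) e f = ax⁻ (trans (↭-sym f) x)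
  cutᵃ≤-introduced D n m l v (⊥L x) e f with ↭-∷-cases (trans (↭-sym x) e)
  ... | inj₁ (refl , _) with v
  ...   | ()
  cutᵃ≤-introduced D n m l v (⊥L x) e f | inj₂ (_ , _ , q) = ⊥L q
  cutᵃ≤-introduced D n m l v (⊤L x) e f = ⊤L (trans (↭-sym f) x)
  cutᵃ≤-introduced D n m l v ⊥R⁻ e f = ⊥R⁻
  cutᵃ≤-introduced D n m l v ⊤R⁺ e f = ⊤R⁺
  cutᵃ≤-introduced D n (suc m) l v (∧R⁺ a b) e f =
    ∧R⁺ (cutᵃ≤-introduced D n m l v a e f) (cutᵃ≤-introduced D n m l v b e f)
  cutᵃ≤-introduced D n (suc m) l v (∧R⁻₁ a) e f = ∧R⁻₁ (cutᵃ≤-introduced D n m l v a e f)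
  cutᵃ≤-introduced D n (suc m) l v (∧R⁻₂ a) e f = ∧R⁻₂ (cutᵃ≤-introduced D n m l v a e f)
  cutᵃ≤-introduced D n (suc m) l v (∨R⁺₁ a) e f = ∨R⁺₁ (cutᵃ≤-introduced D n m l v a e f)
  cutᵃ≤-introduced D n (suc m) l v (∨R⁺₂ a) e f = ∨R⁺₂ (cutᵃ≤-introduced D n m l v a e f)
  cutᵃ≤-introduced D n (suc m) l v (∨R⁻ a b) e f =
    ∨R⁻ (cutᵃ≤-introduced D n m l v a e f) (cutᵃ≤-introduced D n m l v b e f)
  cutᵃ≤-introduced D n (suc m) l v (⇒R⁻ a b) e f =
    ⇒R⁻ (cutᵃ≤-introduced D n m l v a e f) (cutᵃ≤-introduced D n m l v b e f)
  cutᵃ≤-introduced D n (suc m) l v (-<R⁺ a b) e f =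
    -<R⁺ (cutᵃ≤-introduced D n m l v a e f) (cutᵃ≤-introduced D n m l v b e f)
  cutᵃ≤-introduced D n (suc m) l v (⇒R⁺ {A = X} a) e f =
    ⇒R⁺ (cutᵃ≤ D n m (weaken [ X ] [] refl refl l) a (↭-under [ X ] e) f)
  cutᵃ≤-introduced D n (suc m) l v (-<R⁻ {B = Y} a) e f =
    -<R⁻ (cutᵃ≤ D n m (weaken [] [ Y ] refl refl l) a e (prep Y f))
  cutᵃ≤-introduced D n (suc m) l v (∧Lᵃ {A = X} {B = Y} x a) e f with ↭-∷-cases (trans (↭-sym x) e)
  ... | inj₁ (eq , p)      = cutᵃ-∧ D m eq v a p f
  ... | inj₂ (_ , p , q)   = ∧Lᵃ q (cutᵃ≤ D n m (∧Lᵃ-inv l q refl refl) a (↭-under (X ∷ Y ∷ []) p) f)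
  cutᵃ≤-introduced D n (suc m) l v (∧Lᶜ x a b) e f =
    ∧Lᶜ q (cutᵃ≤ D n m (∧Lᶜ-inv₁ l q refl refl) a e refl) (cutᵃ≤ D n m (∧Lᶜ-inv₂ l q refl refl) b e refl)
    where q = trans (↭-sym f) x
  cutᵃ≤-introduced D n (suc m) l v (∨Lᵃ {A = X} {B = Y} x a b) e f with ↭-∷-cases (trans (↭-sym x) e)
  ... | inj₁ (eq , p)      = cutᵃ-∨ D m eq v a b p f
  ... | inj₂ (_ , p , q)   = ∨Lᵃ q (cutᵃ≤ D n m (∨Lᵃ-inv₁ l q refl refl) a (↭-under [ X ] p) f)
                                   (cutᵃ≤ D n m (∨Lᵃ-inv₂ l q refl refl) b (↭-under [ Y ] p) f)
  cutᵃ≤-introduced D n (suc m) l v (∨Lᶜ x a) e f = ∨Lᶜ q (cutᵃ≤ D n m (∨Lᶜ-inv l q refl refl) a e refl)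
    where q = trans (↭-sym f) x
  cutᵃ≤-introduced D n (suc m) l v (⇒Lᵃ {B = Y} x a b) e f with ↭-∷-cases (trans (↭-sym x) e)
  ... | inj₁ (eq , p)      = cutᵃ-⇒ D n m eq l v a b e p f
  ... | inj₂ (_ , p , q)   =
    ⇒Lᵃ q (cutᵃ≤-introduced D n m l v a e f) (cutᵃ≤ D n m (⇒Lᵃ-inv l q refl refl) b (↭-under [ Y ] p) f)
  cutᵃ≤-introduced D n (suc m) l v (⇒Lᶜ {A = X} x a) e f =
    ⇒Lᶜ q (cutᵃ≤ D n m (⇒Lᶜ-inv l q refl refl) a (↭-under [ X ] e) refl)
    where q = trans (↭-sym f) x
  cutᵃ≤-introduced D n (suc m) l v (-<Lᵃ {A = X} {B = Y} x a) e f with ↭-∷-cases (trans (↭-sym x) e)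
  ... | inj₁ (eq , p)      = cutᵃ-co D m eq v a p f
  ... | inj₂ (_ , p , q)   = -<Lᵃ q (cutᵃ≤ D n m (-<Lᵃ-inv l q refl refl) a (↭-under [ X ] p) (prep Y f))
  cutᵃ≤-introduced D n (suc m) l v (-<Lᶜ x a b) e f =
    -<Lᶜ q (cutᵃ≤-introduced D n m l v a e f) (cutᵃ≤ D n m (-<Lᶜ-inv l q refl refl) b e refl)
    where q = trans (↭-sym f) x

  cutᵃ-∧ : ∀ D m → (X ∧f Y) ≡ D → RightRule⁺ Γ Δ D → SC2Int≤ m (X ∷ Y ∷ Γ₁) Δ₁ s C →
           Γ₁ ↭ Γ → Δ₁ ↭ Δ → SC2Int Γ Δ s C
  cutᵃ-∧ (A ∧f B) m refl (∧R⁺ ⊢A ⊢B) r p f =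
    cutᵃ A (toSC2Int ⊢A) (cutᵃ≤ B _ m (weaken [ A ] [] refl refl ⊢B) r (swap A B p) f) refl refl

  cutᵃ-∨ : ∀ D m → (X ∨f Y) ≡ D → RightRule⁺ Γ Δ D →
           SC2Int≤ m (X ∷ Γ₁) Δ₁ s C → SC2Int≤ m (Y ∷ Γ₁) Δ₁ s C →
           Γ₁ ↭ Γ → Δ₁ ↭ Δ → SC2Int Γ Δ s C
  cutᵃ-∨ (A ∨f B) m refl (∨R⁺₁ ⊢A) r₁ r₂ p f = cutᵃ≤ A _ m ⊢A r₁ (prep A p) f
  cutᵃ-∨ (A ∨f B) m refl (∨R⁺₂ ⊢B) r₁ r₂ p f = cutᵃ≤ B _ m ⊢B r₂ (prep B p) f

  cutᵃ-⇒ : ∀ D n m → (X ⇒f Y) ≡ D → SC2Int≤ n Γ Δ pos D → RightRule⁺ Γ Δ D →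
           SC2Int≤ m Γ₁ Δ₁ pos X → SC2Int≤ m (Y ∷ Γ₂) Δ₁ s C →
           Γ₁ ↭ D ∷ Γ → Γ₂ ↭ Γ → Δ₁ ↭ Δ → SC2Int Γ Δ s C
  cutᵃ-⇒ (A ⇒f B) n m refl l (⇒R⁺ A⊢B) r₁ r₂ e p f =
    cutᵃ B (cutᵃ A (cutᵃ≤ (A ⇒f B) n m l r₁ e f) (toSC2Int A⊢B) refl refl) (toSC2Int r₂) (prep B p) f

  cutᵃ-co : ∀ D m → (X -< Y) ≡ D → RightRule⁺ Γ Δ D → SC2Int≤ m (X ∷ Γ₁) (Y ∷ Δ₁) s C →
            Γ₁ ↭ Γ → Δ₁ ↭ Δ → SC2Int Γ Δ s C
  cutᵃ-co (A -< B) m refl (-<R⁺ ⊢A ⊢⁻B) r p f =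
    cutᵃ A (toSC2Int ⊢A) (cutᶜ≤ B _ m (weaken [ A ] [] refl refl ⊢⁻B) r (prep A p) (prep B f)) refl refl

  cutᶜ≤ : ∀ D n m → SC2Int≤ n Γ Δ neg D → SC2Int≤ m Γ₁ Δ₁ s C →
         Γ₁ ↭ Γ → Δ₁ ↭ D ∷ Δ → SC2Int Γ Δ s C
  cutᶜ≤ D n m (⊥L x) r g f = ⊥L x
  cutᶜ≤ D n m (⊤L x) r g f = ⊤L x
  cutᶜ≤ D (suc n) m (∧Lᵃ x a) r g f = ∧Lᵃ x (cutᶜ≤ D n m a (∧Lᵃ-inv r (trans g x) refl refl) refl f)
  cutᶜ≤ D (suc n) m (∧Lᶜ {A = X} {B = Y} x a b) r g f =
    ∧Lᶜ x (cutᶜ≤ D n m a (∧Lᶜ-inv₁ r (trans f (↭-under [ D ] x)) refl (swap D X refl)) g refl)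
          (cutᶜ≤ D n m b (∧Lᶜ-inv₂ r (trans f (↭-under [ D ] x)) refl (swap D Y refl)) g refl)
  cutᶜ≤ D (suc n) m (∨Lᵃ x a b) r g f =
    ∨Lᵃ x (cutᶜ≤ D n m a (∨Lᵃ-inv₁ r (trans g x) refl refl) refl f)
          (cutᶜ≤ D n m b (∨Lᵃ-inv₂ r (trans g x) refl refl) refl f)
  cutᶜ≤ D (suc n) m (∨Lᶜ {A = X} {B = Y} x a) r g f =
    ∨Lᶜ x (cutᶜ≤ D n m a (∨Lᶜ-inv r (trans f (↭-under [ D ] x)) refl (↭-sym (↭-under (X ∷ Y ∷ []) refl)))
                g refl)
  cutᶜ≤ D (suc n) m (⇒Lᵃ x a b) r g f =
    ⇒Lᵃ x (toSC2Int a) (cutᶜ≤ D n m b (⇒Lᵃ-inv r (trans g x) refl refl) refl f)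
  cutᶜ≤ D (suc n) m (⇒Lᶜ {A = X} {B = Y} x a) r g f =
    ⇒Lᶜ x (cutᶜ≤ D n m a (⇒Lᶜ-inv r (trans f (↭-under [ D ] x)) refl (swap D Y refl)) (prep X g) refl)
  cutᶜ≤ D (suc n) m (-<Lᵃ {B = Y} x a) r g f =
    -<Lᵃ x (cutᶜ≤ D n m a (-<Lᵃ-inv r (trans g x) refl refl) refl (↭-under [ Y ] f))
  cutᶜ≤ D (suc n) m (-<Lᶜ {A = X} x a b) r g f =
    -<Lᶜ x (toSC2Int a) (cutᶜ≤ D n m b (-<Lᶜ-inv r (trans f (↭-under [ D ] x)) refl (swap D X refl)) g refl)
  cutᶜ≤ D n m l@(ax⁻ x)   r g f = cutᶜ≤-introduced D n m l (ax⁻ x) r g f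
  cutᶜ≤ D n m l@⊥R⁻       r g f = cutᶜ≤-introduced D n m l ⊥R⁻ r g f
  cutᶜ≤ D n m l@(∧R⁻₁ a)  r g f = cutᶜ≤-introduced D n m l (∧R⁻₁ a) r g f
  cutᶜ≤ D n m l@(∧R⁻₂ a)  r g f = cutᶜ≤-introduced D n m l (∧R⁻₂ a) r g f
  cutᶜ≤ D n m l@(∨R⁻ a b) r g f = cutᶜ≤-introduced D n m l (∨R⁻ a b) r g f
  cutᶜ≤ D n m l@(⇒R⁻ a b) r g f = cutᶜ≤-introduced D n m l (⇒R⁻ a b) r g f
  cutᶜ≤ D n m l@(-<R⁻ a)  r g f = cutᶜ≤-introduced D n m l (-<R⁻ a) r g f

  cutᶜ≤-introduced : ∀ D n m → SC2Int≤ n Γ Δ neg D → RightRule⁻ Γ Δ D → SC2Int≤ m Γ₁ Δ₁ s C →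
                    Γ₁ ↭ Γ → Δ₁ ↭ D ∷ Δ → SC2Int Γ Δ s C
  cutᶜ≤-introduced D n m l v (ax⁺ x) g f = ax⁺ (trans (↭-sym g) x)
  cutᶜ≤-introduced D n m l v (⊥L x) g f = ⊥L (trans (↭-sym g) x)
  cutᶜ≤-introduced D n m l v (ax⁻ x) g f with ↭-∷-cases (trans (↭-sym x) f)
  ... | inj₁ (refl , _)    = toSC2Int l
  ... | inj₂ (_ , _ , q)   = ax⁻ q
  cutᶜ≤-introduced D n m l v (⊤L x) g f with ↭-∷-cases (trans (↭-sym x) f)
  ... | inj₁ (refl , _) with v
  ...   | ()
  cutᶜ≤-introduced D n m l v (⊤L x) g f | inj₂ (_ , _ , q) = ⊤L q
  cutᶜ≤-introduced D n m l v ⊥R⁻ g f = ⊥R⁻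
  cutᶜ≤-introduced D n m l v ⊤R⁺ g f = ⊤R⁺
  cutᶜ≤-introduced D n (suc m) l v (∧R⁺ a b) g f =
    ∧R⁺ (cutᶜ≤-introduced D n m l v a g f) (cutᶜ≤-introduced D n m l v b g f)
  cutᶜ≤-introduced D n (suc m) l v (∧R⁻₁ a) g f = ∧R⁻₁ (cutᶜ≤-introduced D n m l v a g f)
  cutᶜ≤-introduced D n (suc m) l v (∧R⁻₂ a) g f = ∧R⁻₂ (cutᶜ≤-introduced D n m l v a g f)
  cutᶜ≤-introduced D n (suc m) l v (∨R⁺₁ a) g f = ∨R⁺₁ (cutᶜ≤-introduced D n m l v a g f)
  cutᶜ≤-introduced D n (suc m) l v (∨R⁺₂ a) g f = ∨R⁺₂ (cutᶜ≤-introduced D n m l v a g f)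
  cutᶜ≤-introduced D n (suc m) l v (∨R⁻ a b) g f =
    ∨R⁻ (cutᶜ≤-introduced D n m l v a g f) (cutᶜ≤-introduced D n m l v b g f)
  cutᶜ≤-introduced D n (suc m) l v (⇒R⁻ a b) g f =
    ⇒R⁻ (cutᶜ≤-introduced D n m l v a g f) (cutᶜ≤-introduced D n m l v b g f)
  cutᶜ≤-introduced D n (suc m) l v (-<R⁺ a b) g f =
    -<R⁺ (cutᶜ≤-introduced D n m l v a g f) (cutᶜ≤-introduced D n m l v b g f)
  cutᶜ≤-introduced D n (suc m) l v (⇒R⁺ {A = X} a) g f =
    ⇒R⁺ (cutᶜ≤ D n m (weaken [ X ] [] refl refl l) a (prep X g) f)
  cutᶜ≤-introduced D n (suc m) l v (-<R⁻ {B = Y} a) g f =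
    -<R⁻ (cutᶜ≤ D n m (weaken [] [ Y ] refl refl l) a g (↭-under [ Y ] f))
  cutᶜ≤-introduced D n (suc m) l v (∧Lᵃ x a) g f =
    ∧Lᵃ q (cutᶜ≤ D n m (∧Lᵃ-inv l q refl refl) a refl f)
    where q = trans (↭-sym g) x
  cutᶜ≤-introduced D n (suc m) l v (∨Lᵃ x a b) g f =
    ∨Lᵃ q (cutᶜ≤ D n m (∨Lᵃ-inv₁ l q refl refl) a refl f) (cutᶜ≤ D n m (∨Lᵃ-inv₂ l q refl refl) b refl f)
    where q = trans (↭-sym g) x
  cutᶜ≤-introduced D n (suc m) l v (⇒Lᵃ x a b) g f =
    ⇒Lᵃ q (cutᶜ≤-introduced D n m l v a g f) (cutᶜ≤ D n m (⇒Lᵃ-inv l q refl refl) b refl f)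
    where q = trans (↭-sym g) x
  cutᶜ≤-introduced D n (suc m) l v (-<Lᵃ {B = Y} x a) g f =
    -<Lᵃ q (cutᶜ≤ D n m (-<Lᵃ-inv l q refl refl) a refl (↭-under [ Y ] f))
    where q = trans (↭-sym g) x
  cutᶜ≤-introduced D n (suc m) l v (⇒Lᶜ {A = X} {B = Y} x a) g f with ↭-∷-cases (trans (↭-sym x) f)
  ... | inj₁ (eq , p)      = cutᶜ-⇒ D m eq v a g p
  ... | inj₂ (_ , p , q)   = ⇒Lᶜ q (cutᶜ≤ D n m (⇒Lᶜ-inv l q refl refl) a (prep X g) (↭-under [ Y ] p))
  cutᶜ≤-introduced D n (suc m) l v (∧Lᶜ {A = X} {B = Y} x a b) g f with ↭-∷-cases (trans (↭-sym x) f)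
  ... | inj₁ (eq , p)      = cutᶜ-∧ D m eq v a b g p
  ... | inj₂ (_ , p , q)   = ∧Lᶜ q (cutᶜ≤ D n m (∧Lᶜ-inv₁ l q refl refl) a g (↭-under [ X ] p))
                                   (cutᶜ≤ D n m (∧Lᶜ-inv₂ l q refl refl) b g (↭-under [ Y ] p))
  cutᶜ≤-introduced D n (suc m) l v (∨Lᶜ {A = X} {B = Y} x a) g f with ↭-∷-cases (trans (↭-sym x) f)
  ... | inj₁ (eq , p)      = cutᶜ-∨ D m eq v a g p
  ... | inj₂ (_ , p , q)   = ∨Lᶜ q (cutᶜ≤ D n m (∨Lᶜ-inv l q refl refl) a g (↭-under (X ∷ Y ∷ []) p))
  cutᶜ≤-introduced D n (suc m) l v (-<Lᶜ {A = X} x a b) g f with ↭-∷-cases (trans (↭-sym x) f)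
  ... | inj₁ (eq , p)      = cutᶜ-co D n m eq l v a b g f p
  ... | inj₂ (_ , p , q)   =
    -<Lᶜ q (cutᶜ≤-introduced D n m l v a g f) (cutᶜ≤ D n m (-<Lᶜ-inv l q refl refl) b g (↭-under [ X ] p))

  cutᶜ-∧ : ∀ D m → (X ∧f Y) ≡ D → RightRule⁻ Γ Δ D →
           SC2Int≤ m Γ₁ (X ∷ Δ₁) s C → SC2Int≤ m Γ₁ (Y ∷ Δ₁) s C →
           Γ₁ ↭ Γ → Δ₁ ↭ Δ → SC2Int Γ Δ s C
  cutᶜ-∧ (A ∧f B) m refl (∧R⁻₁ ⊢A) r₁ r₂ g p = cutᶜ≤ A _ m ⊢A r₁ g (prep A p)
  cutᶜ-∧ (A ∧f B) m refl (∧R⁻₂ ⊢B) r₁ r₂ g p = cutᶜ≤ B _ m ⊢B r₂ g (prep B p)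

  cutᶜ-∨ : ∀ D m → (X ∨f Y) ≡ D → RightRule⁻ Γ Δ D → SC2Int≤ m Γ₁ (X ∷ Y ∷ Δ₁) s C →
           Γ₁ ↭ Γ → Δ₁ ↭ Δ → SC2Int Γ Δ s C
  cutᶜ-∨ (A ∨f B) m refl (∨R⁻ ⊢A ⊢B) r g p =
    cutᶜ A (toSC2Int ⊢A) (cutᶜ≤ B _ m (weaken [] [ A ] refl refl ⊢B) r g (swap A B p)) refl refl

  cutᶜ-⇒ : ∀ D m → (X ⇒f Y) ≡ D → RightRule⁻ Γ Δ D → SC2Int≤ m (X ∷ Γ₁) (Y ∷ Δ₁) s C →
           Γ₁ ↭ Γ → Δ₁ ↭ Δ → SC2Int Γ Δ s C
  cutᶜ-⇒ (A ⇒f B) m refl (⇒R⁻ ⊢⁺A ⊢B) r g p =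
    cutᵃ A (toSC2Int ⊢⁺A) (cutᶜ≤ B _ m (weaken [ A ] [] refl refl ⊢B) r (prep A g) (prep B p)) refl refl

  cutᶜ-co : ∀ D n m → (X -< Y) ≡ D → SC2Int≤ n Γ Δ neg D → RightRule⁻ Γ Δ D →
            SC2Int≤ m Γ₁ Δ₁ neg Y → SC2Int≤ m Γ₁ (X ∷ Δ₂) s C →
            Γ₁ ↭ Γ → Δ₁ ↭ D ∷ Δ → Δ₂ ↭ Δ → SC2Int Γ Δ s C
  cutᶜ-co (A -< B) n m refl l (-<R⁻ B⊢A) r₁ r₂ g f p =
    cutᶜ A (cutᶜ B (cutᶜ≤ (A -< B) n m l r₁ g f) (toSC2Int B⊢A) refl refl) (toSC2Int r₂) g (prep A p)

cutᵃ-admissible : CutᵃAdmissible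
cutᵃ-admissible {Γ} {Δ} {Γ′} {Δ′} {D} ⊢D D⊢C = cutᵃ≤ D _ _ ⊢D′ D⊢C′ refl refl
  where ⊢D′  = weaken Γ′ Δ′ (++-comm Γ Γ′) (++-comm Δ Δ′) (proj₂ (fromSC2Int ⊢D))
        D⊢C′ = weaken Γ Δ (↭-sym (shift D Γ Γ′)) refl (proj₂ (fromSC2Int D⊢C))

cutᶜ-admissible : CutᶜAdmissible
cutᶜ-admissible {Γ} {Δ} {Γ′} {Δ′} {D} ⊢D D⊢C = cutᶜ≤ D _ _ ⊢D′ D⊢C′ refl refl
  where ⊢D′  = weaken Γ′ Δ′ (++-comm Γ Γ′) (++-comm Δ Δ′) (proj₂ (fromSC2Int ⊢D))
        D⊢C′ = weaken Γ Δ refl (↭-sym (shift D Δ Δ′)) (proj₂ (fromSC2Int D⊢C))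

theorem3p4p2 : CutᵃAdmissible × CutᶜAdmissible
theorem3p4p2 = cutᵃ-admissible , cutᶜ-admissible
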